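{- Let $\mathcal{J}=\mathcal{I}(101,102,201,210)$ be the set of inversion sequences avoiding the patterns $101,102,201,210$. For $n\ge0$ and $h\ge0$ let $\mathcal{A}_{n,h}$ be the set of non-decreasing inversion sequences of length $n$ ending with value $h$ (with the empty sequence in $\mathcal{A}_{0,0}$), and for $\ell\ge0$ let $\mathcal{E}^{\dagger}_{n,\ell}$ be the set of $a\in\mathcal{J}$ of length $n$ with $a_n=\ell<\max(a)$. Then every element of $\mathcal{J}$ lies in exactly one of these sets, and the one-letter right extensions behave as follows (this is the succession rule with root $(0,0)_a$, $(n,h)_a\leadsto(n+1,i)_a$ for $i\in[h,n]$, $(n,h)_a\leadsto(i)_{e^\dagger}$ for $i\in[0,h-1]$, $(\ell)_{e^\dagger}\leadsto(\ell)_{e^\dagger}$): for $a\in\mathcal{A}_{n,h}$, the sequences $a\circ(i)$ lying in $\mathcal{J}$ are exactly those with $i\in[h,n]$, which lie in $\mathcal{A}_{n+1,i}$, and those with $i\in[0,h-1]$, which lie in $\mathcal{E}^{\dagger}_{n+1,i}$; for $a\in\mathcal{E}^{\dagger}_{n,\ell}$, the only sequence $a\circ(i)$ lying in $\mathcal{J}$ is $a\circ(\ell)$, which lies in $\mathcal{E}^{\dagger}_{n+1,\ell}$.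
   Context: An inversion sequence of length $n$ is an integer sequence $(a_1,\dots,a_n)$ with $0\le a_i<i$ for all $i$; $a\circ(i)$ denotes appending the value $i$. A sequence contains a pattern $\sigma$ of length $k$ if some subsequence $a_{i_1}\cdots a_{i_k}$ ($i_1<\dots<i_k$) has the same relative order (including equalities) as $\sigma$, and avoids it otherwise. $\max(a)$ is the largest entry of $a$ (taken to be $0$ for the empty sequence). -}

module Defs where

open import Data.Nat using (ℕ; zero; suc; _≤_; _<_; _⊔_)
open import Data.Fin using (Fin; toℕ; cast)
open import Data.List using (List; []; _∷_; length; lookup; foldr; last; _++_; [_])
open import Data.List.Relation.Binary.Sublist.Propositional using (_⊆_)
open import Data.List.Relation.Unary.Linked using (Linked)
open import Data.Maybe using (just)
open import Data.Product using (Σ; ∃; ∃-syntax; _×_)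
open import Data.Sum using (_⊎_)
open import Function.Bundles using (_⇔_)
open import Relation.Binary.PropositionalEquality using (_≡_)
open import Relation.Nullary using (¬_)

-- Inversion sequence (a₁,…,aₙ) stored as a list; 0-based position p holds a_{p+1},
-- so the condition 0 ≤ a_i < i reads  lookup a p < 1 + p.
IsInversionSeq : List ℕ → Set
IsInversionSeq a = ∀ (p : Fin (length a)) → lookup a p < suc (toℕ p)

SameOrder : List ℕ → List ℕ → Set
SameOrder s σ = Σ (length s ≡ length σ) λ eq →
  ∀ (i j : Fin (length s)) →
    (lookup s i ≤ lookup s j) ⇔ (lookup σ (cast eq i) ≤ lookup σ (cast eq j))

Contains : List ℕ → List ℕ → Set
Contains a σ = ∃[ s ] (s ⊆ a × SameOrder s σ)

Avoids : List ℕ → List ℕ → Set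
Avoids a σ = ¬ Contains a σ

InJ : List ℕ → Set
InJ a = IsInversionSeq a
      × Avoids a (1 ∷ 0 ∷ 1 ∷ [])
      × Avoids a (1 ∷ 0 ∷ 2 ∷ [])
      × Avoids a (2 ∷ 0 ∷ 1 ∷ [])
      × Avoids a (2 ∷ 1 ∷ 0 ∷ [])

maxSeq : List ℕ → ℕ
maxSeq = foldr _⊔_ 0

_∘⟨_⟩ : List ℕ → ℕ → List ℕ
a ∘⟨ i ⟩ = a ++ [ i ]

InA : ℕ → ℕ → List ℕ → Set
InA n h a = IsInversionSeq a × Linked _≤_ a × length a ≡ n
          × ((a ≡ [] × h ≡ 0) ⊎ last a ≡ just h)

InE : ℕ → ℕ → List ℕ → Set
InE n ℓ a = InJ a × length a ≡ n × last a ≡ just ℓ × ℓ < maxSeq a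

data Label : Set where
  labA : ℕ → ℕ → Label
  labE : ℕ → ℕ → Label

InLabel : Label → List ℕ → Set
InLabel (labA n h) a = InA n h a
InLabel (labE n ℓ) a = InE n ℓ a

{-# OPTIONS --safe #-}
-- The four patterns 101, 102, 201, 210 are precisely the order types of the
-- triples x y z with y < x and z ≠ y.  So a ∈ 𝒥 means: after any descent x > y,
-- every later entry equals y.  Such a sequence is non-decreasing up to its first
-- descent and constant afterwards; it lies in 𝒜 when its last entry is its
-- maximum, and in ℰ† when it has already descended, in which case the only
-- admissible new entry is the repeated last one.  A non-decreasing sequence of
-- length n ending in h accepts every i ≤ n: for i ≥ h it stays non-decreasing,
-- for i < h the entry i is its first descent.
module Submission where

open import Defs
open import Data.Nat using (ℕ; suc; _+_; _≤_; _<_; z≤n; s≤s; z<s; s<s; _≤?_)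
open import Data.Nat.Properties
  using ( ≤-refl; ≤-trans; ≤-reflexive; ≤-antisym; ≤-pred; <-trans; <-≤-trans; <-cmp
        ; <⇒≤; <⇒≱; ≰⇒>; ≮⇒≥; +-suc; +-comm; m≤m⊔n; m≤n⊔m; ⊔-lub; ⊔-monoʳ-≤)
open import Data.Fin using (Fin; toℕ; zero; suc; cast)
open import Data.List using (List; []; _∷_; length; lookup; last; initLast; _∷ʳ′_)
open import Data.List.Properties using (length-++; ∷ʳ-injective)
open import Data.List.Membership.Propositional using (_∈_; find)
open import Data.List.Membership.Propositional.Properties using (∈-++⁺ˡ; ∈-++⁺ʳ)
open import Data.List.Relation.Binary.Sublist.Propositional
  using (_⊆_; []; _∷_; _∷ʳ_; ⊆-refl; from∈)
open import Data.List.Relation.Binary.Sublist.Propositional.Properties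
  using (++⁺; ++⁺ˡ; All-resp-⊆)
open import Data.List.Relation.Unary.All using (All; []; _∷_; all?)
import Data.List.Relation.Unary.All.Properties as All
open import Data.List.Relation.Unary.AllPairs using (AllPairs; []; _∷_)
open import Data.List.Relation.Unary.Any using (here; there)
open import Data.List.Relation.Unary.Linked using (Linked; []; [-]; _∷_)
open import Data.List.Relation.Unary.Linked.Properties using (Linked⇒AllPairs)
  renaming (++⁺ to Linked-++⁺)
open import Data.Maybe using (just)
open import Data.Maybe.Properties using (just-injective)
open import Data.Maybe.Relation.Binary.Connected using (Connected; just; nothing-just)
open import Data.Product using (∃-syntax; _×_; _,_; proj₁)
open import Data.Sum using (_⊎_; inj₁; inj₂)
open import Data.Empty using (⊥-elim)
open import Function.Bundles using (_⇔_; mk⇔; Equivalence)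
open import Relation.Binary.Core using (Rel)
open import Relation.Binary.Definitions using (tri<; tri≈; tri>)
open import Relation.Binary.PropositionalEquality using (_≡_; _≢_; refl; sym; trans; cong; subst)
open import Relation.Nullary using (¬_; yes; no)

open Equivalence using (to)

private
  variable
    A : Set
    R : Rel A _
    s t : List A
    a : List ℕ
    h i ℓ n n′ h′ x y z : ℕ

EndsWith : List ℕ → ℕ → Set
EndsWith a h = (a ≡ [] × h ≡ 0) ⊎ last a ≡ just h

length-∘ : ∀ a → length (a ∘⟨ i ⟩) ≡ suc (length a)
length-∘ a = trans (length-++ a) (+-comm (length a) 1)

last-∘ : ∀ a → last (a ∘⟨ i ⟩) ≡ just i
last-∘ []          = refl
last-∘ (_ ∷ [])    = refl
last-∘ (_ ∷ y ∷ a) = last-∘ (y ∷ a)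

last⇒∘ : ∀ a → last a ≡ just h → ∃[ b ] a ≡ b ∘⟨ h ⟩
last⇒∘ (_ ∷ [])    refl = [] , refl
last⇒∘ (x ∷ y ∷ a) e    = let b , eq = last⇒∘ (y ∷ a) e in x ∷ b , cong (x ∷_) eq

⊆-∘⁻ : ∀ a → s ⊆ a ∘⟨ i ⟩ → s ⊆ a ⊎ ∃[ t ] (s ≡ t ∘⟨ i ⟩ × t ⊆ a)
⊆-∘⁻ []      (_ ∷ʳ τ)    = inj₁ τ
⊆-∘⁻ []      (refl ∷ []) = inj₂ ([] , refl , [])
⊆-∘⁻ (x ∷ a) (_ ∷ʳ τ) with ⊆-∘⁻ a τ
... | inj₁ σ              = inj₁ (x ∷ʳ σ)
... | inj₂ (t , refl , σ) = inj₂ (t , refl , x ∷ʳ σ)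
⊆-∘⁻ (x ∷ a) (refl ∷ τ) with ⊆-∘⁻ a τ
... | inj₁ σ              = inj₁ (refl ∷ σ)
... | inj₂ (t , refl , σ) = inj₂ (x ∷ t , refl , refl ∷ σ)

∘-⊆-∘⁻ : ∀ s a → s ∘⟨ z ⟩ ⊆ a ∘⟨ i ⟩ → s ∘⟨ z ⟩ ⊆ a ⊎ (s ⊆ a × z ≡ i)
∘-⊆-∘⁻ s a τ with ⊆-∘⁻ a τ
... | inj₁ σ = inj₁ σ
... | inj₂ (t , eq , σ) with ∷ʳ-injective s t eq
...   | refl , z≡i = inj₂ (σ , z≡i)

AllPairs-resp-⊆ : s ⊆ t → AllPairs R t → AllPairs R s
AllPairs-resp-⊆ []         _        = []
AllPairs-resp-⊆ (_ ∷ʳ τ)   (_ ∷ rs) = AllPairs-resp-⊆ τ rs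
AllPairs-resp-⊆ (refl ∷ τ) (r ∷ rs) = All-resp-⊆ τ r ∷ AllPairs-resp-⊆ τ rs

sorted-⊆⇒≤ : Linked _≤_ a → (x ∷ y ∷ s) ⊆ a → x ≤ y
sorted-⊆⇒≤ sorted τ with AllPairs-resp-⊆ τ (Linked⇒AllPairs ≤-trans sorted)
... | (x≤y ∷ _) ∷ _ = x≤y

endsWith-connected : EndsWith a h → h ≤ i → Connected _≤_ (last a) (just i)
endsWith-connected (inj₁ (refl , _)) _  = nothing-just
endsWith-connected (inj₂ e) h≤i rewrite e = just h≤i

sorted-∘ : Linked _≤_ a → EndsWith a h → h ≤ i → Linked _≤_ (a ∘⟨ i ⟩)
sorted-∘ sorted end h≤i = Linked-++⁺ sorted (endsWith-connected end h≤i) [-]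

ConstantAfterDescent : List ℕ → Set
ConstantAfterDescent a = ∀ {x y z} → (x ∷ y ∷ z ∷ []) ⊆ a → y < x → z ≡ y

constantAfterDescent-tail : ConstantAfterDescent (x ∷ a) → ConstantAfterDescent a
constantAfterDescent-tail cad τ = cad (_ ∷ʳ τ)

sorted⇒constantAfterDescent-∘ : ∀ a → Linked _≤_ a → ConstantAfterDescent (a ∘⟨ i ⟩)
sorted⇒constantAfterDescent-∘ a sorted {x} {y} τ y<x with ∘-⊆-∘⁻ (x ∷ y ∷ []) a τ
... | inj₁ σ       = ⊥-elim (<⇒≱ y<x (sorted-⊆⇒≤ sorted σ))
... | inj₂ (σ , _) = ⊥-elim (<⇒≱ y<x (sorted-⊆⇒≤ sorted σ))

-- A triple ending in the repeated ℓ either has its descent inside b, where cad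
-- already forces the entry after it to be ℓ, or has the old last ℓ as its middle.
constantAfterDescent-repeatLast : ∀ b → ConstantAfterDescent (b ∘⟨ ℓ ⟩) →
                                  ConstantAfterDescent (b ∘⟨ ℓ ⟩ ∘⟨ ℓ ⟩)
constantAfterDescent-repeatLast {ℓ} b cad {x} {y} τ y<x with ∘-⊆-∘⁻ (x ∷ y ∷ []) (b ∘⟨ ℓ ⟩) τ
... | inj₁ σ = cad σ y<x
... | inj₂ (σ , refl) with ∘-⊆-∘⁻ (x ∷ []) b σ
...   | inj₁ ρ        = cad (++⁺ ρ ⊆-refl) y<x
...   | inj₂ (_ , y≡ℓ) = sym y≡ℓ

constantAfterDescent⇒sorted : ∀ b → All (_≤ ℓ) b → ConstantAfterDescent (b ∘⟨ ℓ ⟩) →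
                              Linked _≤_ (b ∘⟨ ℓ ⟩)
constantAfterDescent⇒sorted []          _             _   = [-]
constantAfterDescent⇒sorted (c ∷ [])    (c≤ℓ ∷ [])    _   = c≤ℓ ∷ [-]
constantAfterDescent⇒sorted (c ∷ d ∷ b) (c≤ℓ ∷ d∷b≤ℓ) cad =
  c≤d ∷ constantAfterDescent⇒sorted (d ∷ b) d∷b≤ℓ (constantAfterDescent-tail cad)
  where
  c≤d : c ≤ d
  c≤d = ≮⇒≥ λ d<c → <⇒≱ d<c (subst (c ≤_) (cad (refl ∷ refl ∷ ++⁺ˡ b ⊆-refl) d<c) c≤ℓ)

data SameComparison (u v p q : ℕ) : Set where
  both< : u < v → p < q → SameComparison u v p q
  both≡ : u ≡ v → p ≡ q → SameComparison u v p q
  both> : v < u → q < p → SameComparison u v p q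

sameComparison-refl : SameComparison x x y y
sameComparison-refl = both≡ refl refl

sameComparison-flip : ∀ {u v p q} → SameComparison u v p q → SameComparison v u q p
sameComparison-flip (both< u<v p<q) = both> u<v p<q
sameComparison-flip (both≡ u≡v p≡q) = both≡ (sym u≡v) (sym p≡q)
sameComparison-flip (both> v<u q<p) = both< v<u q<p

sameComparison⇒⇔ : ∀ {u v p q} → SameComparison u v p q → (u ≤ v ⇔ p ≤ q)
sameComparison⇒⇔ (both< u<v p<q)   = mk⇔ (λ _ → <⇒≤ p<q) (λ _ → <⇒≤ u<v)
sameComparison⇒⇔ (both≡ refl refl) = mk⇔ (λ _ → ≤-refl) (λ _ → ≤-refl)
sameComparison⇒⇔ (both> v<u q<p)   =
  mk⇔ (λ u≤v → ⊥-elim (<⇒≱ v<u u≤v)) (λ p≤q → ⊥-elim (<⇒≱ q<p p≤q))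

sameOrder₃ : ∀ {p q r} →
             SameComparison x y p q → SameComparison x z p r → SameComparison y z q r →
             SameOrder (x ∷ y ∷ z ∷ []) (p ∷ q ∷ r ∷ [])
sameOrder₃ {x} {y} {z} {p} {q} {r} xy xz yz = refl , λ i j → sameComparison⇒⇔ (compare i j)
  where
  compare : ∀ i j → SameComparison (lookup (x ∷ y ∷ z ∷ []) i) (lookup (x ∷ y ∷ z ∷ []) j)
                                   (lookup (p ∷ q ∷ r ∷ []) (cast refl i))
                                   (lookup (p ∷ q ∷ r ∷ []) (cast refl j))
  compare zero             zero             = sameComparison-refl
  compare zero             (suc zero)       = xy
  compare zero             (suc (suc zero)) = xz
  compare (suc zero)       zero             = sameComparison-flip xy
  compare (suc zero)       (suc zero)       = sameComparison-refl
  compare (suc zero)       (suc (suc zero)) = yz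
  compare (suc (suc zero)) zero             = sameComparison-flip xz
  compare (suc (suc zero)) (suc zero)       = sameComparison-flip yz
  compare (suc (suc zero)) (suc (suc zero)) = sameComparison-refl

InJ⇒constantAfterDescent : InJ a → ConstantAfterDescent a
InJ⇒constantAfterDescent (_ , avoid101 , avoid102 , avoid201 , avoid210) {x} {y} {z} τ y<x
  with <-cmp z y
... | tri< z<y _ _ = ⊥-elim (avoid210 (_ , τ ,
        sameOrder₃ (both> y<x (s<s z<s)) (both> (<-trans z<y y<x) z<s) (both> z<y z<s)))
... | tri≈ _ z≡y _ = z≡y
... | tri> _ _ y<z with <-cmp x z
...   | tri< x<z _ _ = ⊥-elim (avoid102 (_ , τ ,
          sameOrder₃ (both> y<x z<s) (both< x<z (s<s z<s)) (both< y<z z<s)))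
...   | tri≈ _ x≡z _ = ⊥-elim (avoid101 (_ , τ ,
          sameOrder₃ (both> y<x z<s) (both≡ x≡z refl) (both< y<z z<s)))
...   | tri> _ _ z<x = ⊥-elim (avoid201 (_ , τ ,
          sameOrder₃ (both> y<x z<s) (both> z<x (s<s z<s)) (both< y<z z<s)))

constantAfterDescent⇒avoids : ∀ {p q r} → q < p → q ≢ r → ConstantAfterDescent a →
                              Avoids a (p ∷ q ∷ r ∷ [])
constantAfterDescent⇒avoids _ _ _ ([]                , _ , () , _)
constantAfterDescent⇒avoids _ _ _ (_ ∷ []            , _ , () , _)
constantAfterDescent⇒avoids _ _ _ (_ ∷ _ ∷ []        , _ , () , _)
constantAfterDescent⇒avoids _ _ _ (_ ∷ _ ∷ _ ∷ _ ∷ _ , _ , () , _)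
constantAfterDescent⇒avoids q<p q≢r cad (x ∷ y ∷ z ∷ [] , τ , refl , order) =
  q≢r (≤-antisym (to (order (suc zero) (suc (suc zero))) (≤-reflexive (sym z≡y)))
                 (to (order (suc (suc zero)) (suc zero)) (≤-reflexive z≡y)))
  where
  z≡y : z ≡ y
  z≡y = cad τ (≰⇒> λ x≤y → <⇒≱ q<p (to (order zero (suc zero)) x≤y))

constantAfterDescent⇒InJ : IsInversionSeq a → ConstantAfterDescent a → InJ a
constantAfterDescent⇒InJ inv cad =
  inv , constantAfterDescent⇒avoids z<s (λ ()) cad , constantAfterDescent⇒avoids z<s (λ ()) cad
      , constantAfterDescent⇒avoids z<s (λ ()) cad , constantAfterDescent⇒avoids (s<s z<s) (λ ()) cad

-- A suffix of an inversion sequence that starts after k entries.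
IsInversionSeqFrom : ℕ → List ℕ → Set
IsInversionSeqFrom k a = ∀ (p : Fin (length a)) → lookup a p < suc (k + toℕ p)

isInversionSeqFrom-tail : ∀ k a → IsInversionSeqFrom k (x ∷ a) → IsInversionSeqFrom (suc k) a
isInversionSeqFrom-tail k a inv p =
  subst (λ m → lookup a p < suc m) (+-suc k (toℕ p)) (inv (suc p))

isInversionSeqFrom-∘⁺ : ∀ k a → IsInversionSeqFrom k a → i ≤ k + length a →
                        IsInversionSeqFrom k (a ∘⟨ i ⟩)
isInversionSeqFrom-∘⁺     k []      _   i≤k zero    = s≤s i≤k
isInversionSeqFrom-∘⁺     k (_ ∷ a) inv _   zero    = inv zero
isInversionSeqFrom-∘⁺ {i} k (_ ∷ a) inv i≤ (suc p) =
  subst (λ m → lookup (a ∘⟨ i ⟩) p < suc m) (sym (+-suc k (toℕ p)))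
    (isInversionSeqFrom-∘⁺ (suc k) a (isInversionSeqFrom-tail k a inv)
                           (subst (i ≤_) (+-suc k (length a)) i≤) p)

isInversionSeqFrom-∘⁻ : ∀ k a → IsInversionSeqFrom k (a ∘⟨ i ⟩) → i ≤ k + length a
isInversionSeqFrom-∘⁻     k []      inv = ≤-pred (inv zero)
isInversionSeqFrom-∘⁻ {i} k (_ ∷ a) inv =
  subst (i ≤_) (sym (+-suc k (length a)))
    (isInversionSeqFrom-∘⁻ (suc k) a (isInversionSeqFrom-tail k (a ∘⟨ i ⟩) inv))

isInversionSeq-∘⁺ : ∀ a → IsInversionSeq a → i ≤ length a → IsInversionSeq (a ∘⟨ i ⟩)
isInversionSeq-∘⁺ = isInversionSeqFrom-∘⁺ 0

isInversionSeq-∘⁻ : ∀ a → IsInversionSeq (a ∘⟨ i ⟩) → i ≤ length a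
isInversionSeq-∘⁻ = isInversionSeqFrom-∘⁻ 0

isInversionSeq-last< : ∀ b → IsInversionSeq (b ∘⟨ ℓ ⟩) → ℓ < length (b ∘⟨ ℓ ⟩)
isInversionSeq-last< b inv = subst (_ <_) (sym (length-∘ b)) (s≤s (isInversionSeq-∘⁻ b inv))

∈⇒≤maxSeq : x ∈ a → x ≤ maxSeq a
∈⇒≤maxSeq {a = c ∷ a} (here refl)  = m≤m⊔n c (maxSeq a)
∈⇒≤maxSeq {a = c ∷ a} (there x∈a) = ≤-trans (∈⇒≤maxSeq x∈a) (m≤n⊔m c (maxSeq a))

maxSeq≤ : All (_≤ n) a → maxSeq a ≤ n
maxSeq≤ []          = z≤n
maxSeq≤ (c≤n ∷ a≤n) = ⊔-lub c≤n (maxSeq≤ a≤n)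

maxSeq-∘ : ∀ a → maxSeq a ≤ maxSeq (a ∘⟨ i ⟩)
maxSeq-∘ []      = z≤n
maxSeq-∘ (c ∷ a) = ⊔-monoʳ-≤ c (maxSeq-∘ a)

sorted⇒maxSeq≤last : Linked _≤_ a → last a ≡ just ℓ → maxSeq a ≤ ℓ
sorted⇒maxSeq≤last [-]                      refl = ⊔-lub ≤-refl z≤n
sorted⇒maxSeq≤last (_∷_ {y = y} x≤y sorted) e =
  ⊔-lub (≤-trans x≤y (≤-trans (m≤m⊔n y _) max≤ℓ)) max≤ℓ
  where
  max≤ℓ = sorted⇒maxSeq≤last sorted e

allBelow⊎someAbove : ∀ ℓ b → All (_≤ ℓ) b ⊎ ∃[ m ] (m ∈ b × ℓ < m)
allBelow⊎someAbove ℓ b with all? (_≤? ℓ) b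
... | yes b≤ℓ = inj₁ b≤ℓ
... | no  b≰ℓ =
  let m , m∈b , m≰ℓ = find (All.¬All⇒Any¬ (_≤? ℓ) b b≰ℓ) in inj₂ (m , m∈b , ≰⇒> m≰ℓ)

last<maxSeq⇒above : ∀ b → ℓ < maxSeq (b ∘⟨ ℓ ⟩) → ∃[ m ] (m ∈ b × ℓ < m)
last<maxSeq⇒above {ℓ} b ℓ<max with allBelow⊎someAbove ℓ b
... | inj₁ b≤ℓ  = ⊥-elim (<⇒≱ ℓ<max (maxSeq≤ (All.++⁺ b≤ℓ (≤-refl ∷ []))))
... | inj₂ above = above

label : InJ a → ∃[ L ] InLabel L a
label {a} j with initLast a
... | []      = labA 0 0 , (λ ()) , [] , refl , inj₁ (refl , refl)
... | b ∷ʳ′ ℓ with allBelow⊎someAbove ℓ b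
...   | inj₁ b≤ℓ =
  labA _ ℓ , proj₁ j , constantAfterDescent⇒sorted b b≤ℓ (InJ⇒constantAfterDescent j)
           , refl , inj₂ (last-∘ b)
...   | inj₂ (m , m∈b , ℓ<m) =
  labE _ ℓ , j , refl , last-∘ b , <-≤-trans ℓ<m (∈⇒≤maxSeq (∈-++⁺ˡ m∈b))

endsWith-unique : EndsWith a h → EndsWith a h′ → h ≡ h′
endsWith-unique (inj₁ (_ , refl)) (inj₁ (_ , refl)) = refl
endsWith-unique (inj₁ (refl , _)) (inj₂ ())
endsWith-unique (inj₂ ())         (inj₁ (refl , _))
endsWith-unique (inj₂ e)          (inj₂ e′)         = just-injective (trans (sym e) e′)

InA∩InE-empty : InA n h a → ¬ InE n′ ℓ a
InA∩InE-empty (_ , sorted , _ , _) (_ , _ , e , ℓ<max) =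
  <⇒≱ ℓ<max (sorted⇒maxSeq≤last sorted e)

InLabel-functional : ∀ {L L′} → InLabel L a → InLabel L′ a → L ≡ L′
InLabel-functional {L = labA _ _} {labA _ _} (_ , _ , refl , e) (_ , _ , refl , e′) =
  cong (labA _) (endsWith-unique e e′)
InLabel-functional {L = labA _ _} {labE _ _} α ε = ⊥-elim (InA∩InE-empty α ε)
InLabel-functional {L = labE _ _} {labA _ _} ε α = ⊥-elim (InA∩InE-empty α ε)
InLabel-functional {L = labE _ _} {labE _ _} (_ , refl , e , _) (_ , refl , e′ , _) =
  cong (labE _) (just-injective (trans (sym e) e′))

InA-extension-bound : InA n h a → InJ (a ∘⟨ i ⟩) → i ≤ n
InA-extension-bound {a = a} (_ , _ , refl , _) (inv , _) = isInversionSeq-∘⁻ a inv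

InA-extension-InA : InA n h a → h ≤ i → i ≤ n → InJ (a ∘⟨ i ⟩) × InA (suc n) i (a ∘⟨ i ⟩)
InA-extension-InA {a = a} (inv , sorted , refl , end) h≤i i≤n =
  constantAfterDescent⇒InJ inv′ (sorted⇒constantAfterDescent-∘ a sorted) ,
  inv′ , sorted-∘ sorted end h≤i , length-∘ a , inj₂ (last-∘ a)
  where
  inv′ = isInversionSeq-∘⁺ a inv i≤n

InA-extension-InE : InA n h a → i < h → InE (suc n) i (a ∘⟨ i ⟩)
InA-extension-InE (_ , _ , _ , inj₁ (_ , refl)) ()
InA-extension-InE {h = h} {a = a} (inv , sorted , refl , inj₂ e) i<h with last⇒∘ a e
... | b , refl =
  constantAfterDescent⇒InJ inv′ (sorted⇒constantAfterDescent-∘ (b ∘⟨ h ⟩) sorted) ,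
  length-∘ (b ∘⟨ h ⟩) , last-∘ (b ∘⟨ h ⟩) ,
  <-≤-trans i<h (≤-trans (∈⇒≤maxSeq (∈-++⁺ʳ b (here refl))) (maxSeq-∘ (b ∘⟨ h ⟩)))
  where
  inv′ = isInversionSeq-∘⁺ (b ∘⟨ h ⟩) inv (<⇒≤ (<-trans i<h (isInversionSeq-last< b inv)))

InE-extension-forced : InE n ℓ a → InJ (a ∘⟨ i ⟩) → i ≡ ℓ
InE-extension-forced {a = a} (_ , _ , e , ℓ<max) j with last⇒∘ a e
... | b , refl =
  let m , m∈b , ℓ<m = last<maxSeq⇒above b ℓ<max
  in InJ⇒constantAfterDescent j (++⁺ (++⁺ (from∈ m∈b) ⊆-refl) ⊆-refl) ℓ<m

InE-extension-InE : InE n ℓ a → InE (suc n) ℓ (a ∘⟨ ℓ ⟩)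
InE-extension-InE {ℓ = ℓ} {a = a} (j@(inv , _) , refl , e , ℓ<max) with last⇒∘ a e
... | b , refl =
  constantAfterDescent⇒InJ inv′ (constantAfterDescent-repeatLast b (InJ⇒constantAfterDescent j)) ,
  length-∘ (b ∘⟨ ℓ ⟩) , last-∘ (b ∘⟨ ℓ ⟩) , <-≤-trans ℓ<max (maxSeq-∘ (b ∘⟨ ℓ ⟩))
  where
  inv′ = isInversionSeq-∘⁺ (b ∘⟨ ℓ ⟩) inv (<⇒≤ (isInversionSeq-last< b inv))

mainTheorem12 :
    -- every element of 𝒥 lies in exactly one of the sets 𝒜_{n,h}, ℰ†_{n,ℓ}
    (∀ (a : List ℕ) → InJ a →
      ∃[ L ] (InLabel L a × (∀ L′ → InLabel L′ a → L′ ≡ L)))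
    -- extensions of a ∈ 𝒜_{n,h}
    × (∀ n h a → InA n h a →
        (∀ i → InJ (a ∘⟨ i ⟩) → i ≤ n)
        × (∀ i → h ≤ i → i ≤ n → InJ (a ∘⟨ i ⟩) × InA (suc n) i (a ∘⟨ i ⟩))
        × (∀ i → i < h → InE (suc n) i (a ∘⟨ i ⟩)))
    -- extensions of a ∈ ℰ†_{n,ℓ}
    × (∀ n ℓ a → InE n ℓ a →
        (∀ i → InJ (a ∘⟨ i ⟩) → i ≡ ℓ)
        × InE (suc n) ℓ (a ∘⟨ ℓ ⟩))
mainTheorem12 =
    (λ a j → let L , a∈L = label j in L , a∈L , λ L′ a∈L′ → InLabel-functional a∈L′ a∈L)
  , (λ n h a α → (λ i → InA-extension-bound α) , (λ i → InA-extension-InA α)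
                                              , (λ i → InA-extension-InE α))
  , (λ n ℓ a ε → (λ i → InE-extension-forced ε) , InE-extension-InE ε)
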